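{- Let $X\in\{K,D,T,B,S4,S5\}$, let $\phi\in\mathcal{L}^{\cap}$ and let $s$ be a state of the standard model $\mathcal{M}^X$. Then $\mathcal{M}^X,s\models\phi$ if and only if $\phi\in\mathrm{tail}(s)$.
   Context: Fix a countably infinite set $P$ of propositional variables and an at most countable set $\mathbb{I}$ of primitive types. An index is a finite nonempty subset of $\mathbb{I}$. The language $\mathcal{L}^{\cap}$ is given by $\phi ::= p \mid \neg\phi \mid (\phi\to\phi) \mid \Box_i\phi \mid [\cap_I]\phi$ with $p\in P$, $i\in\mathbb{I}$, $I$ an index. A Kripke model is $M=(S,R,V)$ with $S\neq\emptyset$, $R$ assigning to each $i\in\mathbb{I}$ a binary relation $R_i$ on $S$, $V:P\to\wp(S)$. Truth: $M,s\models p$ iff $s\in V(p)$; Boolean clauses as usual; $M,s\models\Box_i\phi$ iff $M,t\models\phi$ for all $t$ with $(s,t)\in R_i$; $M,s\models[\cap_I]\phi$ iff $M,t\models\phi$ for all $t$ with $(s,t)\in\bigcap_{i\in I}R_i$. Axiomatizations (all schemes instantiated over $\mathcal{L}^{\cap}$, for all $i\in\mathbb{I}$ and all indices $I,J$): $\Lambda_K^{\cap}$ consists of all propositional tautologies, modus ponens, (K) $\Box_i(\phi\to\psi)\to(\Box_i\phi\to\Box_i\psi)$, (N) from $\phi$ infer $\Box_i\phi$, (K$\cap$) $[\cap_I](\phi\to\psi)\to([\cap_I]\phi\to[\cap_I]\psi)$, (N$\cap$) from $\phi$ infer $[\cap_I]\phi$, ($\cap$1) $\Box_i\phi\leftrightarrow[\cap_{\{i\}}]\phi$,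 ($\cap$2) $[\cap_I]\phi\to[\cap_J]\phi$ whenever $I\subseteq J$. Further: $\Lambda_D^{\cap}=\Lambda_K^{\cap}+$(D) $\Box_i\phi\to\neg\Box_i\neg\phi$; $\Lambda_T^{\cap}=\Lambda_K^{\cap}+$(T) $\Box_i\phi\to\phi$ $+$(T$\cap$) $[\cap_I]\phi\to\phi$; $\Lambda_B^{\cap}=\Lambda_T^{\cap}+$(B) $\neg\phi\to\Box_i\neg\Box_i\phi$ $+$(B$\cap$) $\neg\phi\to[\cap_I]\neg[\cap_I]\phi$; $\Lambda_{S4}^{\cap}=\Lambda_T^{\cap}+$(4) $\Box_i\phi\to\Box_i\Box_i\phi$ $+$(4$\cap$) $[\cap_I]\phi\to[\cap_I][\cap_I]\phi$; $\Lambda_{S5}^{\cap}=\Lambda_T^{\cap}+$(5) $\neg\Box_i\phi\to\Box_i\neg\Box_i\phi$ $+$(5$\cap$) $\neg[\cap_I]\phi\to[\cap_I]\neg[\cap_I]\phi$. For $X$ fixed write $\Lambda=\Lambda_X^{\cap}$. $\mathrm{MCS}^{\Lambda}$ is the set of maximal $\Lambda$-consistent sets of $\mathcal{L}^{\cap}$-formulas; for an index $I$, $\Phi\rhd_I\Psi$ iff for every $\phi$, $[\cap_I]\phi\in\Phi$ implies $\phi\in\Psi$. A canonical path for $\Lambda$ is a sequence $\langle\Phi_0,I_0,\Phi_1,\ldots,I_{n-1},\Phi_n\rangle$ ($n\ge 0$) with $\Phi_x\in\mathrm{MCS}^{\Lambda}$, $I_x$ indices, and $\Phi_x\rhd_{I_x}\Phi_{x+1}$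 for all $x<n$. For canonical paths $s=\langle\Phi_0,I_0,\ldots,\Phi_m\rangle$, $t=\langle\Psi_0,J_0,\ldots,\Psi_n\rangle$: $s$ is an initial segment of $t$ if $m\le n$, $\Phi_x=\Psi_x$ for $x\le m$ and $I_y=J_y$ for $y<m$; then $t$ extends $s$ with $\langle J_m,\Psi_{m+1},\ldots,J_{n-1},\Psi_n\rangle$ and $t\setminus s=\langle\Psi_m,J_m,\ldots,J_{n-1},\Psi_n\rangle$. $\mathrm{tail}(s)=\Phi_m$. A path is an $i$-path if $i$ belongs to all its indices (a one-element path is trivially an $i$-path). Standard relations $\mathcal{R}^X_i$ ($i\in\mathbb{I}$) on canonical paths for $\Lambda$: for $X\in\{K,D\}$: $(s,t)\in\mathcal{R}^X_i$ iff $t$ extends $s$ with $\langle I,\Phi\rangle$ for some index $I\ni i$ and $\Phi\in\mathrm{MCS}^\Lambda$; for $X=T$: iff $t=s$ or $t$ extends $s$ with such $\langle I,\Phi\rangle$; for $X=B$: iff $t=s$, or $s$ extends $t$ with some $\langle I,\Phi\rangle$ with $i\in I$, or $t$ extends $s$ with some $\langle I,\Phi\rangle$ with $i\in I$; for $X=S4$: iff $s$ is an initial segment of $t$ and $t\setminus s$ is an $i$-path; for $X=S5$: iff $s$ and $t$ have a common initial segment $u$ such that both $s\setminus u$ and $t\setminus u$ are $i$-paths. The standard model $\mathcal{M}^X=(\mathcal{S},\mathcal{R},\mathcal{V})$ has as states all canonical paths for $\Lambda$, $\mathcal{R}_i=\mathcal{R}^X_i$, and $\mathcal{V}(p)=\{s\mid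 p\in\mathrm{tail}(s)\}$. -}

module Defs where

open import Level using (Level; Lift; lift) renaming (suc to lsuc; zero to lzero)
open import Data.Nat using (ℕ; _<_)
open import Data.Bool using (Bool; true; false; not; _∨_)
open import Data.List using (List; []; _∷_; foldr)
open import Data.List.Relation.Unary.All using (All)
open import Data.List.Relation.Unary.Linked using (Linked; [-])
import Data.List.Membership.Propositional as ListMem
open import Data.Product using (Σ; _×_; _,_)
open import Data.Sum using (_⊎_)
open import Data.Unit using (⊤)
open import Data.Empty using (⊥)
open import Relation.Nullary using (¬_)
open import Relation.Binary.PropositionalEquality using (_≡_)

data System : Set where
  K D T B S4 S5 : System

HasT : System → Set
HasT K  = ⊥
HasT D  = ⊥
HasT T  = ⊤
HasT B  = ⊤
HasT S4 = ⊤
HasT S5 = ⊤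

-- Everything else is parametric in the set 𝕀 of primitive types, given
-- together with a map  code : 𝕀 → ℕ  (assumed injective in the theorem,
-- which expresses that 𝕀 is at most countable).

module Logic (𝕀 : Set) (code : 𝕀 → ℕ) where

  _<ᶜ_ : 𝕀 → 𝕀 → Set
  a <ᶜ b = code a < code b

  -- An index: a finite nonempty subset of 𝕀, represented canonically as a
  -- nonempty list strictly increasing w.r.t. code (so equal subsets have
  -- equal representations).
  record Index : Set where
    constructor index
    field
      hd     : 𝕀
      tl     : List 𝕀
      sorted : Linked _<ᶜ_ (hd ∷ tl)

  elems : Index → List 𝕀
  elems I = Index.hd I ∷ Index.tl I

  _∈ᵢ_ : 𝕀 → Index → Set
  i ∈ᵢ I = ListMem._∈_ i (elems I)

  _⊆ᵢ_ : Index → Index → Set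
  I ⊆ᵢ J = ∀ i → i ∈ᵢ I → i ∈ᵢ J

  ⟦_⟧ : 𝕀 → Index
  ⟦ i ⟧ = index i [] [-]

  infixr 5 _⇒_
  data Form : Set where
    var  : ℕ → Form
    ¬'_  : Form → Form
    _⇒_  : Form → Form → Form
    □    : 𝕀 → Form → Form
    [∩_] : Index → Form → Form

  _∧'_ : Form → Form → Form
  φ ∧' ψ = ¬' (φ ⇒ ¬' ψ)

  _⇔'_ : Form → Form → Form
  φ ⇔' ψ = (φ ⇒ ψ) ∧' (ψ ⇒ φ)

  ⊥' : Form
  ⊥' = ¬' (var 0 ⇒ var 0)

  _⇒*_ : List Form → Form → Form
  ψs ⇒* χ = foldr _⇒_ χ ψs

  eval : (Form → Bool) → Form → Bool
  eval v (var p)     = v (var p)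
  eval v (¬' φ)      = not (eval v φ)
  eval v (φ ⇒ ψ)     = not (eval v φ) ∨ eval v ψ
  eval v (□ i φ)     = v (□ i φ)
  eval v ([∩ I ] φ)  = v ([∩ I ] φ)

  Tautology : Form → Set
  Tautology φ = ∀ (v : Form → Bool) → eval v φ ≡ true

  data ExtraAx : System → Form → Set where
    axD  : ∀ {i φ} → ExtraAx D (□ i φ ⇒ ¬' □ i (¬' φ))
    axT  : ∀ {X i φ} → HasT X → ExtraAx X (□ i φ ⇒ φ)
    axT∩ : ∀ {X I φ} → HasT X → ExtraAx X ([∩ I ] φ ⇒ φ)
    axB  : ∀ {i φ} → ExtraAx B (¬' φ ⇒ □ i (¬' □ i φ))
    axB∩ : ∀ {I φ} → ExtraAx B (¬' φ ⇒ [∩ I ] (¬' [∩ I ] φ))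
    ax4  : ∀ {i φ} → ExtraAx S4 (□ i φ ⇒ □ i (□ i φ))
    ax4∩ : ∀ {I φ} → ExtraAx S4 ([∩ I ] φ ⇒ [∩ I ] ([∩ I ] φ))
    ax5  : ∀ {i φ} → ExtraAx S5 (¬' □ i φ ⇒ □ i (¬' □ i φ))
    ax5∩ : ∀ {I φ} → ExtraAx S5 (¬' [∩ I ] φ ⇒ [∩ I ] (¬' [∩ I ] φ))

  infix 3 _⊢_
  data _⊢_ (X : System) : Form → Set where
    taut  : ∀ {φ} → Tautology φ → X ⊢ φ
    mp    : ∀ {φ ψ} → X ⊢ (φ ⇒ ψ) → X ⊢ φ → X ⊢ ψ
    axK   : ∀ {i φ ψ} → X ⊢ (□ i (φ ⇒ ψ) ⇒ (□ i φ ⇒ □ i ψ))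
    nec   : ∀ {i φ} → X ⊢ φ → X ⊢ □ i φ
    axK∩  : ∀ {I φ ψ} → X ⊢ ([∩ I ] (φ ⇒ ψ) ⇒ ([∩ I ] φ ⇒ [∩ I ] ψ))
    nec∩  : ∀ {I φ} → X ⊢ φ → X ⊢ [∩ I ] φ
    ax∩1  : ∀ {i φ} → X ⊢ (□ i φ ⇔' [∩ ⟦ i ⟧ ] φ)
    ax∩2  : ∀ {I J φ} → I ⊆ᵢ J → X ⊢ ([∩ I ] φ ⇒ [∩ J ] φ)
    extra : ∀ {φ} → ExtraAx X φ → X ⊢ φ

  FormSet : Set₁
  FormSet = Form → Set

  _⊆ˢ_ : FormSet → FormSet → Set
  Γ ⊆ˢ Δ = ∀ φ → Γ φ → Δ φ

  Consistent : System → FormSet → Set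
  Consistent X Γ = ¬ Σ (List Form) (λ ψs → All Γ ψs × (X ⊢ (ψs ⇒* ⊥')))

  record MCS (X : System) : Set₁ where
    field
      set        : FormSet
      consistent : Consistent X set
      maximal    : ∀ (Δ : FormSet) → set ⊆ˢ Δ → Consistent X Δ → Δ ⊆ˢ set

  _∈ₘ_ : ∀ {X} → Form → MCS X → Set
  φ ∈ₘ Φ = MCS.set Φ φ

  _≈ₘ_ : ∀ {X} → MCS X → MCS X → Set
  Φ ≈ₘ Ψ = ∀ φ → (φ ∈ₘ Φ → φ ∈ₘ Ψ) × (φ ∈ₘ Ψ → φ ∈ₘ Φ)

  _▷[_]_ : ∀ {X} → MCS X → Index → MCS X → Set
  Φ ▷[ I ] Ψ = ∀ φ → ([∩ I ] φ) ∈ₘ Φ → φ ∈ₘ Ψ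

  mutual
    data Path (X : System) : Set₁ where
      start : MCS X → Path X
      snoc  : (s : Path X) (I : Index) (Φ : MCS X) → tail s ▷[ I ] Φ → Path X

    tail : ∀ {X} → Path X → MCS X
    tail (start Φ)        = Φ
    tail (snoc _ _ Φ _)   = Φ

  data _≈ₚ_ {X : System} : Path X → Path X → Set₁ where
    start≈ : ∀ {Φ Ψ} → Φ ≈ₘ Ψ → start Φ ≈ₚ start Ψ
    snoc≈  : ∀ {s t I J Φ Ψ r r'} → s ≈ₚ t → I ≡ J → Φ ≈ₘ Ψ →
             snoc s I Φ r ≈ₚ snoc t J Ψ r'

  data Ext {X : System} (s : Path X) : Path X → Set₁ where
    base : ∀ {t} → s ≈ₚ t → Ext s t
    step : ∀ {t} → Ext s t → (I : Index) (Φ : MCS X) (r : tail t ▷[ I ] Φ) →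
           Ext s (snoc t I Φ r)

  extIndices : ∀ {X} {s t : Path X} → Ext s t → List Index
  extIndices (base _)         = []
  extIndices (step e I _ _)   = I ∷ extIndices e

  IsIPath : ∀ {X} {s t : Path X} → 𝕀 → Ext s t → Set
  IsIPath i e = All (i ∈ᵢ_) (extIndices e)

  data ExtendsOne {X : System} (i : 𝕀) (s : Path X) : Path X → Set₁ where
    ext1 : ∀ {t} (I : Index) (Φ : MCS X) (r : tail t ▷[ I ] Φ) →
           s ≈ₚ t → i ∈ᵢ I → ExtendsOne i s (snoc t I Φ r)

  StdRel : (X : System) → 𝕀 → Path X → Path X → Set₁
  StdRel K  i s t = ExtendsOne i s t
  StdRel D  i s t = ExtendsOne i s t
  StdRel T  i s t = (t ≈ₚ s) ⊎ ExtendsOne i s t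
  StdRel B  i s t = (t ≈ₚ s) ⊎ (ExtendsOne i t s ⊎ ExtendsOne i s t)
  StdRel S4 i s t = Σ (Ext s t) (IsIPath i)
  StdRel S5 i s t = Σ (Path S5) λ u →
                      Σ (Ext u s) (IsIPath i) × Σ (Ext u t) (IsIPath i)

  record Model : Set₂ where
    field
      S : Set₁
      R : 𝕀 → S → S → Set₁
      V : ℕ → S → Set₁

  R∩ : (M : Model) → Index → Model.S M → Model.S M → Set₁
  R∩ M I s t = ∀ i → i ∈ᵢ I → Model.R M i s t

  _,_⊨_ : (M : Model) → Model.S M → Form → Set₁
  M , s ⊨ var p      = Model.V M p s
  M , s ⊨ (¬' φ)     = ¬ (M , s ⊨ φ)
  M , s ⊨ (φ ⇒ ψ)    = M , s ⊨ φ → M , s ⊨ ψ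
  M , s ⊨ □ i φ      = ∀ t → Model.R M i s t → M , t ⊨ φ
  M , s ⊨ [∩ I ] φ   = ∀ t → R∩ M I s t → M , t ⊨ φ

  StdModel : System → Model
  StdModel X = record
    { S = Path X
    ; R = StdRel X
    ; V = λ p s → Lift (lsuc lzero) (var p ∈ₘ tail s)
    }

-- The canonical-model argument. Propositional reasoning is reduced to Boolean valuations, and an
-- injective coding of formulas drives Lindenbaum's construction, which gives the existence lemma:
-- if [∩_I]φ ∉ tail s, some ▷_I-successor Ψ omits φ, and the one-step path snoc s I Ψ is R_i-related
-- to s for every i ∈ I. Conversely, for each system R∩_I s t implies tail s ▷_I tail t. For K, D, T
-- and B the paths differ by at most one step, all i ∈ I must agree on its shape, and (B∩) makes ▷_I
-- symmetric; for S4 (4∩) carries [∩_I]φ forward along the I-path from s to t, for S5 (5∩) carries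
-- it back to the longest common initial segment of the witnesses and forward again, and (T∩)
-- finishes. The □_i case reduces to [∩_{i}] through (∩1).

module Submission where

open import Defs
open import Level using (lift; lower)
open import Data.Bool using (Bool; not) renaming (T to IsTrue)
open import Data.Empty using (⊥; ⊥-elim)
open import Data.List using (List; []; _∷_; _++_; length; map)
open import Data.List.Properties using (∷-injective; ∷-injectiveʳ; map-injective)
open import Data.List.Relation.Unary.All as All using (All; []; _∷_)
open import Data.List.Relation.Unary.All.Properties using (++⁺; ++⁻ˡ; ++⁻ʳ)
open import Data.List.Relation.Unary.Any using (here; there)
open import Data.List.Membership.Propositional using (_∈_)
import Data.List.Relation.Unary.Linked as Linked
open import Data.Nat using (ℕ; zero; suc; _≤_; _≤′_; ≤′-refl; ≤′-step; _⊔_)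
open import Data.Nat.Properties
  using (<-irrelevant; suc-injective; ≤-refl; ≤-reflexive; ≤-trans; ≤-total; ≤⇒≤′;
         m≤m⊔n; m≤n⊔m; n≤1+n; 1+n≢n; 1+n≰n; m≢1+n+m)
open import Data.Nat.Binary using (ℕᵇ; 2[1+_]; 1+[2_]; toℕ) renaming (zero to 0ᵇ)
open import Data.Nat.Binary.Properties using (toℕ-injective; 2[1+_]-injective)
open import Data.Product using (Σ; ∃; _×_; _,_; proj₁; proj₂; swap)
open import Data.Sum using (_⊎_; inj₁; inj₂; [_,_]′)
import Data.Sum as Sum
open import Data.Unit using (tt)
open import Function using (_∘_; id)
open import Function.Bundles using (_⇔_; mk⇔; Equivalence)
open import Function.Construct.Composition using (_⇔-∘_)
open import Function.Construct.Symmetry using (⇔-sym)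
open import Function.Related.TypeIsomorphisms using (→-cong-⇔; ¬-cong-⇔)
open import Relation.Binary.PropositionalEquality using (_≡_; refl; sym; trans; cong)
open import Relation.Nullary using (¬_; Dec)
open import Relation.Nullary.Decidable using (T?; ¬?; _→-dec_; dec-true; decidable-stable)
open import Relation.Unary using (Pred; _⊆_; _∪_; ｛_｝)

open Equivalence using (to; from)

++-cancel-≡length : ∀ {A : Set} (as bs : List A) {xs ys : List A} →
                    length as ≡ length bs → as ++ xs ≡ bs ++ ys → as ≡ bs × xs ≡ ys
++-cancel-≡length []       []       _ e = refl , e
++-cancel-≡length (a ∷ as) (b ∷ bs) l e with ∷-injective e
... | refl , e′ with ++-cancel-≡length as bs (suc-injective l) e′
... | refl , e″ = refl , e″

All-∪ : ∀ {A : Set} {ℓ} {P Q : Pred A ℓ} (xs : List A) → All (P ∪ Q) xs → All P xs ⊎ ∃ Q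
All-∪ []       []            = inj₁ []
All-∪ (x ∷ xs) (inj₂ q ∷ _)  = inj₂ (x , q)
All-∪ (x ∷ xs) (inj₁ p ∷ ps) = Sum.map₁ (p ∷_) (All-∪ xs ps)

module CanonicalModel (𝕀 : Set) (code : 𝕀 → ℕ) (code-injective : ∀ {a b} → code a ≡ code b → a ≡ b) where
  open Logic 𝕀 code

  Sat : (Form → Bool) → Form → Set
  Sat v (var p)    = IsTrue (v (var p))
  Sat v (¬' φ)     = ¬ Sat v φ
  Sat v (φ ⇒ ψ)    = Sat v φ → Sat v ψ
  Sat v (□ i φ)    = IsTrue (v (□ i φ))
  Sat v ([∩ I ] φ) = IsTrue (v ([∩ I ] φ))

  sat? : ∀ v φ → Dec (Sat v φ)
  sat? v (var p)    = T? (v (var p))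
  sat? v (¬' φ)     = ¬? (sat? v φ)
  sat? v (φ ⇒ ψ)    = sat? v φ →-dec sat? v ψ
  sat? v (□ i φ)    = T? (v (□ i φ))
  sat? v ([∩ I ] φ) = T? (v ([∩ I ] φ))

  Sat-stable : ∀ v φ → ¬ ¬ Sat v φ → Sat v φ
  Sat-stable v φ = decidable-stable (sat? v φ)

  eval≡does-sat? : ∀ v φ → eval v φ ≡ Dec.does (sat? v φ)
  eval≡does-sat? v (var p)    = refl
  eval≡does-sat? v (¬' φ)     = cong not (eval≡does-sat? v φ)
  eval≡does-sat? v (φ ⇒ ψ)    rewrite eval≡does-sat? v φ | eval≡does-sat? v ψ = refl
  eval≡does-sat? v (□ i φ)    = refl
  eval≡does-sat? v ([∩ I ] φ) = refl

  ⊢-tautology : ∀ {X φ} → (∀ v → Sat v φ) → X ⊢ φ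
  ⊢-tautology {φ = φ} sat = taut λ v → trans (eval≡does-sat? v φ) (dec-true (sat? v φ) (sat v))

  Sat-⊥' : ∀ v → ¬ Sat v ⊥'
  Sat-⊥' v s = s id

  Sat-⇒* : ∀ {v χ} ψs → Sat v (ψs ⇒* χ) ⇔ (All (Sat v) ψs → Sat v χ)
  Sat-⇒* []       = mk⇔ (λ s _ → s) (λ f → f [])
  Sat-⇒* (ψ ∷ ψs) = mk⇔ (λ { s (p ∷ ps) → to (Sat-⇒* ψs) (s p) ps })
                         (λ f p → from (Sat-⇒* ψs) (f ∘ (p ∷_)))

  elems-injective : ∀ {I J} → elems I ≡ elems J → I ≡ J
  elems-injective {index h t s} {index .h .t s′} refl =
    cong (index h t) (Linked.irrelevant <-irrelevant s s′)

  -- Prefix-free: the second argument is what follows the code of the formula.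
  serialise : Form → List ℕ → List ℕ
  serialise (var p)    xs = 0 ∷ p ∷ xs
  serialise (¬' φ)     xs = 1 ∷ serialise φ xs
  serialise (φ ⇒ ψ)    xs = 2 ∷ serialise φ (serialise ψ xs)
  serialise (□ i φ)    xs = 3 ∷ code i ∷ serialise φ xs
  serialise ([∩ I ] φ) xs = 4 ∷ length (codes I) ∷ codes I ++ serialise φ xs
    where codes = map code ∘ elems

  -- Clauses for different head constructors are absurd (the tags differ); the coverage checker supplies them.
  serialise-injective : ∀ φ ψ {xs ys} → serialise φ xs ≡ serialise ψ ys → φ ≡ ψ × xs ≡ ys
  serialise-injective (var p) (var .p) refl = refl , refl
  serialise-injective (¬' φ) (¬' ψ) e with serialise-injective φ ψ (∷-injectiveʳ e)
  ... | refl , xs≡ys = refl , xs≡ys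
  serialise-injective (φ ⇒ φ′) (ψ ⇒ ψ′) e with serialise-injective φ ψ (∷-injectiveʳ e)
  ... | refl , e′ with serialise-injective φ′ ψ′ e′
  ... | refl , xs≡ys = refl , xs≡ys
  serialise-injective (□ i φ) (□ j ψ) e with ∷-injective (∷-injectiveʳ e)
  ... | ci≡cj , e′ with code-injective ci≡cj | serialise-injective φ ψ e′
  ... | refl | refl , xs≡ys = refl , xs≡ys
  serialise-injective ([∩ I ] φ) ([∩ J ] ψ) e with ∷-injective (∷-injectiveʳ e)
  ... | |I|≡|J| , e′ with ++-cancel-≡length (map code (elems I)) (map code (elems J)) |I|≡|J| e′
  ... | codes≡ , e″ with elems-injective {I} {J} (map-injective code-injective codes≡)
                       | serialise-injective φ ψ e″
  ... | refl | refl , xs≡ys = refl , xs≡ys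

  -- The two digit constructors of ℕᵇ serve as the letters of a unary code for each entry.
  push : ℕ → ℕᵇ → ℕᵇ
  push zero    b = 1+[2 b ]
  push (suc n) b = 2[1+ push n b ]

  push-injective : ∀ m n {b c} → push m b ≡ push n c → m ≡ n × b ≡ c
  push-injective zero    zero    refl = refl , refl
  push-injective (suc m) (suc n) e with push-injective m n (2[1+_]-injective e)
  ... | refl , b≡c = refl , b≡c

  pack : List ℕ → ℕᵇ
  pack []       = 0ᵇ
  pack (n ∷ ns) = push n (pack ns)

  pack-injective : ∀ ms ns → pack ms ≡ pack ns → ms ≡ ns
  pack-injective []       []          _ = refl
  pack-injective []       (zero ∷ _)  ()
  pack-injective []       (suc _ ∷ _) ()
  pack-injective (zero ∷ _)  [] ()
  pack-injective (suc _ ∷ _) [] ()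
  pack-injective (m ∷ ms) (n ∷ ns) e with push-injective m n e
  ... | refl , e′ = cong (m ∷_) (pack-injective ms ns e′)

  encode : Form → ℕ
  encode φ = toℕ (pack (serialise φ []))

  encode-injective : ∀ {φ ψ} → encode φ ≡ encode ψ → φ ≡ ψ
  encode-injective {φ} {ψ} e =
    proj₁ (serialise-injective φ ψ (pack-injective _ _ (toℕ-injective e)))

  infix 3 _⊢[_]_
  _⊢[_]_ : FormSet → System → Form → Set
  Γ ⊢[ X ] φ = Σ (List Form) λ ψs → All Γ ψs × (X ⊢ ψs ⇒* φ)

  module _ {X : System} where

    ⊢-mono : ∀ {Γ Δ φ} → Γ ⊆ Δ → Γ ⊢[ X ] φ → Δ ⊢[ X ] φ
    ⊢-mono Γ⊆Δ (ψs , ps , d) = ψs , All.map Γ⊆Δ ps , d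

    ⊢-assumption : ∀ {Γ φ} → Γ φ → Γ ⊢[ X ] φ
    ⊢-assumption p = _ ∷ [] , p ∷ [] , ⊢-tautology λ _ → id

    ⊢-mp : ∀ {Γ φ ψ} → Γ ⊢[ X ] (φ ⇒ ψ) → Γ ⊢[ X ] φ → Γ ⊢[ X ] ψ
    ⊢-mp {φ = φ} {ψ} (ψs , ps , d) (χs , qs , e) =
      ψs ++ χs , ++⁺ ps qs , mp (mp (⊢-tautology joint) d) e
      where
      joint : ∀ v → Sat v ((ψs ⇒* (φ ⇒ ψ)) ⇒ (χs ⇒* φ) ⇒ ((ψs ++ χs) ⇒* ψ))
      joint v f g = from (Sat-⇒* (ψs ++ χs)) λ sats →
        to (Sat-⇒* ψs) f (++⁻ˡ ψs sats) (to (Sat-⇒* χs) g (++⁻ʳ ψs sats))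

    ⊢-consequence : ∀ {Γ φs ψ} → (∀ v → All (Sat v) φs → Sat v ψ) →
                    All (Γ ⊢[ X ]_) φs → Γ ⊢[ X ] ψ
    ⊢-consequence {φs = []}    sem []       = [] , [] , ⊢-tautology λ v → sem v []
    ⊢-consequence {φs = _ ∷ _} sem (d ∷ ds) =
      ⊢-mp (⊢-consequence (λ v sats s → sem v (s ∷ sats)) ds) d

    deduction : ∀ {Γ φ ψ} → (Γ ∪ ｛ φ ｝) ⊢[ X ] ψ → Γ ⊢[ X ] (φ ⇒ ψ)
    deduction {Γ} {φ} {ψ} (ψs , ps , d) =
      discharge ψs ps (⊢-consequence (λ { _ (s ∷ []) _ → s }) (([] , [] , d) ∷ []))
      where
      discharge : ∀ χs → All (Γ ∪ ｛ φ ｝) χs → Γ ⊢[ X ] (φ ⇒ (χs ⇒* ψ)) → Γ ⊢[ X ] (φ ⇒ ψ)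
      discharge []       []               h = h
      discharge (_ ∷ χs) (inj₁ γ ∷ ps)    h =
        discharge χs ps (⊢-consequence (λ { _ (f ∷ c ∷ []) a → f a c }) (h ∷ ⊢-assumption γ ∷ []))
      discharge (_ ∷ χs) (inj₂ refl ∷ ps) h =
        discharge χs ps (⊢-consequence (λ { _ (f ∷ []) a → f a a }) (h ∷ []))

  module _ {X : System} (Φ : MCS X) where
    open MCS Φ

    ∈-if-consistent : ∀ {φ} → Consistent X (set ∪ ｛ φ ｝) → φ ∈ₘ Φ
    ∈-if-consistent c = maximal _ (λ _ → inj₁) c _ (inj₂ refl)

    ⊢-∈ : ∀ {φ} → set ⊢[ X ] φ → φ ∈ₘ Φ
    ⊢-∈ d = ∈-if-consistent λ e → consistent (⊢-mp (deduction e) d)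

    consequence-∈ : ∀ {φs ψ} → (∀ v → All (Sat v) φs → Sat v ψ) → All (_∈ₘ Φ) φs → ψ ∈ₘ Φ
    consequence-∈ sem ms = ⊢-∈ (⊢-consequence sem (All.map ⊢-assumption ms))

    theorem-∈ : ∀ {φ} → X ⊢ φ → φ ∈ₘ Φ
    theorem-∈ d = ⊢-∈ ([] , [] , d)

    ¬'∈⇒∉ : ∀ {φ} → (¬' φ) ∈ₘ Φ → ¬ φ ∈ₘ Φ
    ¬'∈⇒∉ n m = consistent (⊢-consequence (λ { _ (sn ∷ s ∷ []) → ⊥-elim (sn s) })
                                          (⊢-assumption n ∷ ⊢-assumption m ∷ []))

    refuted⇒¬'∈ : ∀ {φ} → (set ∪ ｛ φ ｝) ⊢[ X ] ⊥' → (¬' φ) ∈ₘ Φ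
    refuted⇒¬'∈ d = ⊢-∈ (⊢-consequence (λ { v (f ∷ []) s → Sat-⊥' v (f s) }) (deduction d ∷ []))

    ∈-stable : ∀ {φ} → ¬ ¬ φ ∈ₘ Φ → φ ∈ₘ Φ
    ∈-stable ¬¬m = ∈-if-consistent λ d → ¬¬m (¬'∈⇒∉ (refuted⇒¬'∈ d))

    ¬'-∈ : ∀ {φ} → (¬' φ) ∈ₘ Φ ⇔ (¬ φ ∈ₘ Φ)
    ¬'-∈ = mk⇔ ¬'∈⇒∉ λ ∉ → ∈-stable λ ¬'∉ → ∉ (∈-if-consistent (¬'∉ ∘ refuted⇒¬'∈))

    ∈-mp : ∀ {φ ψ} → (φ ⇒ ψ) ∈ₘ Φ → φ ∈ₘ Φ → ψ ∈ₘ Φ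
    ∈-mp i m = consequence-∈ (λ { _ (f ∷ s ∷ []) → f s }) (i ∷ m ∷ [])

    ∈-mp⊢ : ∀ {φ ψ} → X ⊢ (φ ⇒ ψ) → φ ∈ₘ Φ → ψ ∈ₘ Φ
    ∈-mp⊢ = ∈-mp ∘ theorem-∈

    ⇒-∈ : ∀ {φ ψ} → (φ ⇒ ψ) ∈ₘ Φ ⇔ (φ ∈ₘ Φ → ψ ∈ₘ Φ)
    ⇒-∈ {φ} {ψ} = mk⇔ ∈-mp λ f → ∈-stable λ ∉ →
      ∉ (vacuous (from ¬'-∈ λ m → ∉ (weakening (f m))))
      where
      vacuous : (¬' φ) ∈ₘ Φ → (φ ⇒ ψ) ∈ₘ Φ
      vacuous n = consequence-∈ (λ { _ (sn ∷ []) s → ⊥-elim (sn s) }) (n ∷ [])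
      weakening : ψ ∈ₘ Φ → (φ ⇒ ψ) ∈ₘ Φ
      weakening m = consequence-∈ (λ { _ (s ∷ []) _ → s }) (m ∷ [])

    ⇔'-∈ : ∀ {φ ψ} → (φ ⇔' ψ) ∈ₘ Φ → φ ∈ₘ Φ ⇔ ψ ∈ₘ Φ
    ⇔'-∈ {φ} {ψ} m = mk⇔ (∈-mp (consequence-∈ left (m ∷ []))) (∈-mp (consequence-∈ right (m ∷ [])))
      where
      left : ∀ v → All (Sat v) ((φ ⇔' ψ) ∷ []) → Sat v (φ ⇒ ψ)
      left v (s ∷ []) = Sat-stable v (φ ⇒ ψ) λ n → s λ f _ → n f
      right : ∀ v → All (Sat v) ((φ ⇔' ψ) ∷ []) → Sat v (ψ ⇒ φ)
      right v (s ∷ []) = Sat-stable v (ψ ⇒ φ) λ n → s λ _ → n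

    □-∈ : ∀ {i φ} → □ i φ ∈ₘ Φ ⇔ [∩ ⟦ i ⟧ ] φ ∈ₘ Φ
    □-∈ = ⇔'-∈ (theorem-∈ ax∩1)

    ∩-reflexive : HasT X → ∀ {I φ} → [∩ I ] φ ∈ₘ Φ → φ ∈ₘ Φ
    ∩-reflexive hasT = ∈-mp⊢ (extra (axT∩ hasT))

  ▷-antitone : ∀ {X I J} (Ψ Φ : MCS X) → I ⊆ᵢ J → Ψ ▷[ J ] Φ → Ψ ▷[ I ] Φ
  ▷-antitone Ψ _ I⊆J r φ x = r φ (∈-mp⊢ Ψ (ax∩2 I⊆J) x)

  module Lindenbaum {X : System} (Γ : FormSet) (Γ-consistent : Consistent X Γ) where

    stage : ℕ → FormSet
    stage zero    = Γ
    stage (suc n) = stage n ∪ λ ψ → encode ψ ≡ n × Consistent X (stage n ∪ ｛ ψ ｝)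

    stage-consistent : ∀ n → Consistent X (stage n)
    stage-consistent zero = Γ-consistent
    stage-consistent (suc n) (ψs , ps , d) with All-∪ ψs ps
    ... | inj₁ ps′ = stage-consistent n (ψs , ps′ , d)
    ... | inj₂ (χ , code≡n , χ-consistent) = χ-consistent (ψs , All.map only-χ ps , d)
      where
      only-χ : stage (suc n) ⊆ stage n ∪ ｛ χ ｝
      only-χ (inj₁ p)       = inj₁ p
      only-χ (inj₂ (e , _)) = inj₂ (encode-injective (trans code≡n (sym e)))

    stage-mono′ : ∀ {m n} → m ≤′ n → stage m ⊆ stage n
    stage-mono′ ≤′-refl        p = p
    stage-mono′ (≤′-step m≤′n) p = inj₁ (stage-mono′ m≤′n p)

    stage-mono : ∀ {m n} → m ≤ n → stage m ⊆ stage n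
    stage-mono = stage-mono′ ∘ ≤⇒≤′

    limit : FormSet
    limit ψ = ∃ λ n → stage n ψ

    finitely-staged : ∀ {ψs} → All limit ψs → ∃ λ n → All (stage n) ψs
    finitely-staged [] = 0 , []
    finitely-staged ((m , p) ∷ ps) with finitely-staged ps
    ... | n , qs = m ⊔ n , stage-mono (m≤m⊔n m n) p ∷ All.map (stage-mono (m≤n⊔m m n)) qs

    limit-consistent : Consistent X limit
    limit-consistent (ψs , ps , d) with finitely-staged ps
    ... | n , qs = stage-consistent n (ψs , qs , d)

    limit-maximal : ∀ Δ → limit ⊆ˢ Δ → Consistent X Δ → Δ ⊆ˢ limit
    limit-maximal Δ limit⊆Δ Δ-consistent ψ p =
      suc (encode ψ) , inj₂ (refl , Δ-consistent ∘ ⊢-mono into-Δ)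
      where
      into-Δ : stage (encode ψ) ∪ ｛ ψ ｝ ⊆ Δ
      into-Δ (inj₁ q)    = limit⊆Δ _ (encode ψ , q)
      into-Δ (inj₂ refl) = p

  lindenbaum : ∀ {X Γ} → Consistent X Γ → Σ (MCS X) λ Φ → Γ ⊆ MCS.set Φ
  lindenbaum {X} {Γ} Γ-consistent =
    record { set = limit ; consistent = limit-consistent ; maximal = limit-maximal } ,
    λ p → 0 , p
    where open Lindenbaum Γ Γ-consistent

  Boxed : ∀ {X} → Index → MCS X → FormSet
  Boxed I Φ ψ = [∩ I ] ψ ∈ₘ Φ

  Boxed-⊢ : ∀ {X I φ} (Φ : MCS X) → Boxed I Φ ⊢[ X ] φ → [∩ I ] φ ∈ₘ Φ
  Boxed-⊢ {X} {I} {φ} Φ (ψs , ps , d) = distribute ψs ps (theorem-∈ Φ (nec∩ d))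
    where
    distribute : ∀ χs → All (Boxed I Φ) χs → [∩ I ] (χs ⇒* φ) ∈ₘ Φ → [∩ I ] φ ∈ₘ Φ
    distribute []       []       m = m
    distribute (_ ∷ χs) (b ∷ bs) m = distribute χs bs (∈-mp Φ (∈-mp⊢ Φ axK∩ m) b)

  existence : ∀ {X I φ} (Φ : MCS X) → ¬ [∩ I ] φ ∈ₘ Φ → Σ (MCS X) λ Ψ → Φ ▷[ I ] Ψ × ¬ φ ∈ₘ Ψ
  existence {X} {I} {φ} Φ ∉ =
    let Ψ , Γ⊆Ψ = lindenbaum {Γ = Boxed I Φ ∪ ｛ ¬' φ ｝} consistent
    in  Ψ , (λ _ → Γ⊆Ψ ∘ inj₁) , ¬'∈⇒∉ Ψ (Γ⊆Ψ (inj₂ refl))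
    where
    consistent : Consistent X (Boxed I Φ ∪ ｛ ¬' φ ｝)
    consistent d = ∉ (Boxed-⊢ Φ (⊢-consequence double-negation (deduction d ∷ [])))
      where
      double-negation : ∀ v → All (Sat v) ((¬' φ ⇒ ⊥') ∷ []) → Sat v φ
      double-negation v (f ∷ []) = Sat-stable v φ (Sat-⊥' v ∘ f)

  module _ {X : System} where

    len : Path X → ℕ
    len (start _)      = 0
    len (snoc s _ _ _) = suc (len s)

    ≈ₚ-refl : ∀ {s : Path X} → s ≈ₚ s
    ≈ₚ-refl {start _}      = start≈ λ _ → id , id
    ≈ₚ-refl {snoc _ _ _ _} = snoc≈ ≈ₚ-refl refl λ _ → id , id

    ≈ₚ-len : ∀ {s t : Path X} → s ≈ₚ t → len s ≡ len t
    ≈ₚ-len (start≈ _)      = refl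
    ≈ₚ-len (snoc≈ s≈t _ _) = cong suc (≈ₚ-len s≈t)

    ≈ₚ-tail : ∀ {s t : Path X} → s ≈ₚ t → tail s ≈ₘ tail t
    ≈ₚ-tail (start≈ e)    = e
    ≈ₚ-tail (snoc≈ _ _ e) = e

    ext-len : ∀ {u t : Path X} → Ext u t → len u ≤ len t
    ext-len (base u≈t)     = ≤-reflexive (≈ₚ-len u≈t)
    ext-len (step e _ _ _) = ≤-trans (ext-len e) (n≤1+n _)

    -- If u and u′ are initial segments of s with u no longer than u′, then s ∖ u′ is a suffix of s ∖ u.
    All-deeper : ∀ {P : Index → Set} {u u′ s : Path X} (e : Ext u s) (e′ : Ext u′ s) →
                 len u ≤ len u′ → All P (extIndices e) → All P (extIndices e′)
    All-deeper _ (base _) _ _ = []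
    All-deeper (base u≈s) (step e′ _ _ _) u≤u′ _ =
      ⊥-elim (1+n≰n (≤-trans (≤-reflexive (sym (≈ₚ-len u≈s))) (≤-trans u≤u′ (ext-len e′))))
    All-deeper (step e _ _ _) (step e′ _ _ _) u≤u′ (p ∷ ps) = p ∷ All-deeper e e′ u≤u′ ps

    extendsOne-len : ∀ {i} {s t : Path X} → ExtendsOne i s t → len t ≡ suc (len s)
    extendsOne-len (ext1 _ _ _ s≈t′ _) = cong suc (sym (≈ₚ-len s≈t′))

    extendsOne-≉ : ∀ {i} {s t : Path X} → ExtendsOne i s t → ¬ t ≈ₚ s
    extendsOne-≉ st t≈s = 1+n≢n (trans (sym (extendsOne-len st)) (≈ₚ-len t≈s))

    extendsOne-≉˘ : ∀ {i} {s t : Path X} → ExtendsOne i s t → ¬ s ≈ₚ t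
    extendsOne-≉˘ st s≈t = 1+n≢n (trans (sym (extendsOne-len st)) (sym (≈ₚ-len s≈t)))

    extendsOne-asym : ∀ {i j} {s t : Path X} → ExtendsOne i s t → ¬ ExtendsOne j t s
    extendsOne-asym {s = s} st ts = m≢1+n+m (len s) (trans (extendsOne-len ts) (cong suc (extendsOne-len st)))

    extendsOne-▷ : ∀ {I} {s t : Path X} → (∀ i → i ∈ᵢ I → ExtendsOne i s t) → tail s ▷[ I ] tail t
    extendsOne-▷ {I} R φ x with R _ (here refl)
    ... | ext1 {t′} J Ψ r s≈t′ _ = ▷-antitone (tail t′) Ψ I⊆J r φ (proj₁ (≈ₚ-tail s≈t′ _) x)
      where
      I⊆J : I ⊆ᵢ J
      I⊆J i m with R i m
      ... | ext1 _ _ _ _ i∈J = i∈J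

    ≈ₚ-▷ : HasT X → ∀ {I} {s t : Path X} → t ≈ₚ s → tail s ▷[ I ] tail t
    ≈ₚ-▷ hasT {s = s} t≈s φ x = proj₂ (≈ₚ-tail t≈s φ) (∩-reflexive (tail s) hasT x)

    Ext-forward : ∀ {I α} → (∀ (Ψ Φ : MCS X) → Ψ ▷[ I ] Φ → α ∈ₘ Ψ → α ∈ₘ Φ) →
                  ∀ {u t : Path X} (e : Ext u t) → All (I ⊆ᵢ_) (extIndices e) → α ∈ₘ tail u → α ∈ₘ tail t
    Ext-forward keep (base u≈t)     _          x = proj₁ (≈ₚ-tail u≈t _) x
    Ext-forward keep (step {t} e _ Φ r) (I⊆J ∷ ps) x =
      keep (tail t) Φ (▷-antitone (tail t) Φ I⊆J r) (Ext-forward keep e ps x)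

    Ext-backward : ∀ {I α} → (∀ (Ψ Φ : MCS X) → Ψ ▷[ I ] Φ → α ∈ₘ Φ → α ∈ₘ Ψ) →
                   ∀ {u t : Path X} (e : Ext u t) → All (I ⊆ᵢ_) (extIndices e) → α ∈ₘ tail t → α ∈ₘ tail u
    Ext-backward keep (base u≈t)     _          x = proj₂ (≈ₚ-tail u≈t _) x
    Ext-backward keep (step {t} e _ Φ r) (I⊆J ∷ ps) x =
      Ext-backward keep e ps (keep (tail t) Φ (▷-antitone (tail t) Φ I⊆J r) x)

    All-⊆ᵢ : ∀ {I Js} → (∀ i → i ∈ᵢ I → All (i ∈ᵢ_) Js) → All (I ⊆ᵢ_) Js
    All-⊆ᵢ {Js = []}    _ = []
    All-⊆ᵢ {I} {_ ∷ _} f = (λ i m → All.head (f i m)) ∷ All-⊆ᵢ {I} (λ i m → All.tail (f i m))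

    ext-⊆ᵢ : ∀ {I} {s t : Path X} → (∀ i → i ∈ᵢ I → Σ (Ext s t) (IsIPath i)) →
             Σ (Ext s t) λ e → All (I ⊆ᵢ_) (extIndices e)
    ext-⊆ᵢ {I} R = e , All-⊆ᵢ {I} λ i m → All-deeper (proj₁ (R i m)) e ≤-refl (proj₂ (R i m))
      where e = proj₁ (R _ (here refl))

    CommonSegment : (Index → Set) → Path X → Path X → Set₁
    CommonSegment P s t = Σ (Path X) λ u →
      Σ (Ext u s) (All P ∘ extIndices) × Σ (Ext u t) (All P ∘ extIndices)

    common-map : ∀ {P Q : Index → Set} {s t} → (∀ {J} → P J → Q J) →
                 CommonSegment P s t → CommonSegment Q s t
    common-map f (u , (es , ps) , (et , pt)) = u , (es , All.map f ps) , (et , All.map f pt)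

    common-⊓-deeper : ∀ {P Q : Index → Set} {s t} (c : CommonSegment P s t) (d : CommonSegment Q s t) →
                      len (proj₁ c) ≤ len (proj₁ d) → CommonSegment (λ J → P J × Q J) s t
    common-⊓-deeper (_ , (es , ps) , (et , pt)) (u , (es′ , qs) , (et′ , qt)) c≤d =
      u , (es′ , All.zip (All-deeper es es′ c≤d ps , qs)) , (et′ , All.zip (All-deeper et et′ c≤d pt , qt))

    common-⊓ : ∀ {P Q : Index → Set} {s t} →
               CommonSegment P s t → CommonSegment Q s t → CommonSegment (λ J → P J × Q J) s t
    common-⊓ c d with ≤-total (len (proj₁ c)) (len (proj₁ d))
    ... | inj₁ c≤d = common-⊓-deeper c d c≤d
    ... | inj₂ d≤c = common-map swap (common-⊓-deeper d c d≤c)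

    common-all : ∀ {s t} i is → (∀ j → j ∈ i ∷ is → CommonSegment (j ∈ᵢ_) s t) →
                 CommonSegment (λ J → All (_∈ᵢ J) (i ∷ is)) s t
    common-all i []        R = common-map (_∷ []) (R i (here refl))
    common-all i (i′ ∷ is) R =
      common-map (λ (m , ms) → m ∷ ms) (common-⊓ (R i (here refl)) (common-all i′ is (λ j → R j ∘ there)))

    common-⊆ᵢ : ∀ {I} {s t} → (∀ i → i ∈ᵢ I → CommonSegment (i ∈ᵢ_) s t) → CommonSegment (I ⊆ᵢ_) s t
    common-⊆ᵢ R = common-map (λ a _ → All.lookup a) (common-all _ _ R)

  ⊎-uniform : ∀ {ℓ I} {A B : 𝕀 → Set ℓ} → (∀ {i j} → A i → B j → ⊥) →
              (∀ i → i ∈ᵢ I → A i ⊎ B i) → (∀ i → i ∈ᵢ I → A i) ⊎ (∀ i → i ∈ᵢ I → B i)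
  ⊎-uniform excl R with R _ (here refl)
  ... | inj₁ a = inj₁ λ i m → [ id , (λ b → ⊥-elim (excl a b)) ]′ (R i m)
  ... | inj₂ b = inj₂ λ i m → [ (λ a → ⊥-elim (excl a b)) , id ]′ (R i m)

  ▷-symmetric : ∀ {I} (Ψ Φ : MCS B) → Ψ ▷[ I ] Φ → Φ ▷[ I ] Ψ
  ▷-symmetric Ψ Φ r φ x = ∈-stable Ψ λ ∉ → ¬'∈⇒∉ Φ (r _ (∈-mp⊢ Ψ (extra axB∩) (from (¬'-∈ Ψ) ∉))) x

  ▷-[∩]⇒ : ∀ {I φ} (Ψ Φ : MCS S4) → Ψ ▷[ I ] Φ → [∩ I ] φ ∈ₘ Ψ → [∩ I ] φ ∈ₘ Φ
  ▷-[∩]⇒ Ψ _ r x = r _ (∈-mp⊢ Ψ (extra ax4∩) x)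

  ▷-[∩]⇔ : ∀ {I φ} (Ψ Φ : MCS S5) → Ψ ▷[ I ] Φ → [∩ I ] φ ∈ₘ Ψ ⇔ [∩ I ] φ ∈ₘ Φ
  ▷-[∩]⇔ Ψ Φ r = mk⇔
    (λ x → ∈-stable Φ λ ∉ → ¬'∈⇒∉ Φ (r _ (negative Ψ λ y → ¬'∈⇒∉ Ψ (∩-reflexive Ψ tt y) x)) (negative Φ ∉))
    (λ x → ∈-stable Ψ λ ∉ → ¬'∈⇒∉ Φ (r _ (negative Ψ ∉)) x)
    where
    negative : ∀ {I φ} (Θ : MCS S5) → ¬ [∩ I ] φ ∈ₘ Θ → [∩ I ] (¬' [∩ I ] φ) ∈ₘ Θ
    negative Θ ∉ = ∈-mp⊢ Θ (extra ax5∩) (from (¬'-∈ Θ) ∉)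

  ∩-sound : ∀ X {I} {s t : Path X} → R∩ (StdModel X) I s t → tail s ▷[ I ] tail t
  ∩-sound K R = extendsOne-▷ R
  ∩-sound D R = extendsOne-▷ R
  ∩-sound T {I} R =
    [ (λ R≈ → ≈ₚ-▷ tt (R≈ _ (here refl))) , extendsOne-▷ ]′
    (⊎-uniform {I = I} (λ t≈s st → extendsOne-≉ st t≈s) R)
  ∩-sound B {I} {s} {t} R =
    [ (λ R≈ → ≈ₚ-▷ tt (R≈ _ (here refl)))
    , [ ▷-symmetric (tail t) (tail s) ∘ extendsOne-▷ , extendsOne-▷ ]′ ∘ ⊎-uniform {I = I} extendsOne-asym
    ]′ (⊎-uniform {I = I} (λ t≈s → [ (λ ts → extendsOne-≉˘ ts t≈s) , (λ st → extendsOne-≉ st t≈s) ]′) R)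
  ∩-sound S4 {I} {t = t} R φ x =
    let e , ps = ext-⊆ᵢ {I = I} R
    in  ∩-reflexive (tail t) tt (Ext-forward ▷-[∩]⇒ e ps x)
  ∩-sound S5 {I} {t = t} R φ x =
    let _ , (es , ps) , (et , pt) = common-⊆ᵢ {I = I} R
    in  ∩-reflexive (tail t) tt (Ext-forward (λ Ψ Φ r → to (▷-[∩]⇔ Ψ Φ r)) et pt
                                  (Ext-backward (λ Ψ Φ r → from (▷-[∩]⇔ Ψ Φ r)) es ps x))

  snoc-R∩ : ∀ X {I} {s : Path X} {Ψ} (r : tail s ▷[ I ] Ψ) → R∩ (StdModel X) I s (snoc s I Ψ r)
  snoc-R∩ K  r _ m = ext1 _ _ r ≈ₚ-refl m
  snoc-R∩ D  r _ m = ext1 _ _ r ≈ₚ-refl m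
  snoc-R∩ T  r _ m = inj₂ (ext1 _ _ r ≈ₚ-refl m)
  snoc-R∩ B  r _ m = inj₂ (inj₂ (ext1 _ _ r ≈ₚ-refl m))
  snoc-R∩ S4 r _ m = step (base ≈ₚ-refl) _ _ r , m ∷ []
  snoc-R∩ S5 r _ m = _ , (base ≈ₚ-refl , []) , (step (base ≈ₚ-refl) _ _ r , m ∷ [])

  □⇔[∩⟦⟧] : ∀ (M : Model) {s i φ} → (M , s ⊨ □ i φ) ⇔ (M , s ⊨ [∩ ⟦ i ⟧ ] φ)
  □⇔[∩⟦⟧] M = mk⇔ (λ f t R → f t (R _ (here refl))) (λ f t r → f t λ { _ (here refl) → r })

  ∩-truth : ∀ X φ → (∀ t → (StdModel X , t ⊨ φ) ⇔ (φ ∈ₘ tail t)) →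
            ∀ I s → (StdModel X , s ⊨ [∩ I ] φ) ⇔ ([∩ I ] φ ∈ₘ tail s)
  ∩-truth X φ ih I s = mk⇔
    (λ f → ∈-stable (tail s) λ ∉ →
       let Ψ , r , φ∉Ψ = existence (tail s) ∉ in φ∉Ψ (to (ih _) (f _ (snoc-R∩ X {Ψ = Ψ} r))))
    (λ x t R → from (ih t) (∩-sound X R _ x))

  truth-lemma : ∀ X φ (s : Path X) → (StdModel X , s ⊨ φ) ⇔ (φ ∈ₘ tail s)
  truth-lemma X (var p)    s = mk⇔ lower lift
  truth-lemma X (¬' φ)     s = ⇔-sym (¬'-∈ (tail s)) ⇔-∘ ¬-cong-⇔ (truth-lemma X φ s)
  truth-lemma X (φ ⇒ ψ)    s = ⇔-sym (⇒-∈ (tail s)) ⇔-∘ →-cong-⇔ (truth-lemma X φ s) (truth-lemma X ψ s)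
  truth-lemma X (□ i φ)    s =
    ⇔-sym (□-∈ (tail s)) ⇔-∘ (∩-truth X φ (truth-lemma X φ) ⟦ i ⟧ s ⇔-∘ □⇔[∩⟦⟧] (StdModel X) {φ = φ})
  truth-lemma X ([∩ I ] φ) s = ∩-truth X φ (truth-lemma X φ) I s

lemma3 : (𝕀 : Set) (code : 𝕀 → ℕ) → (∀ {a b} → code a ≡ code b → a ≡ b) →
         (X : System) → let open Logic 𝕀 code in
         (φ : Form) (s : Path X) → (StdModel X , s ⊨ φ) ⇔ (φ ∈ₘ tail s)
lemma3 𝕀 code code-injective = CanonicalModel.truth-lemma 𝕀 code code-injective
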